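{- Let $p\in\{3,\dots,9\}$ and $A\in\mathrm{Avoid}(m,F(0,p,1,0))$ (so $2c_p\ge p$). Then every pair of distinct rows of $A$ is joined by an edge of $G(A)$; if some pair of rows is joined by more than one edge of $G(A)$ (i.e., by directed edges in both directions), then there is a deletion of cost at least $1$; and if the directed graph $D(A)$ is not transitive, then there is a deletion of cost at least $1$.
   Context: A matrix is simple if it is a $(0,1)$-matrix with no repeated columns. $F\prec A$ means some submatrix of $A$ is a row and column permutation of $F$. $\mathrm{Avoid}(m,F)$ is the set of simple $m$-rowed matrices $A$ with $F\not\prec A$. $F(0,p,1,0)$ is the $2\times(p+1)$ matrix with $p$ columns $\binom{1}{0}$ and one column $\binom{0}{1}$. Constants: $c_3=\frac73$, $c_4=\frac{11}4$, $c_5=\frac{15}4$, $c_6=\frac{21}5$, $c_7=\frac{24}5$, $c_8=\frac{27}5$, $c_9=\frac{31}5$. For $A\in\mathrm{Avoid}(m,F(0,p,1,0))$ the graph $G(A)$ on the rows of $A$ has a directed edge $i\to j$ if no column of $A$ has $0$ in row $i$ and $1$ in row $j$, and an undirected edge $i-j$ if there are at most $p-1$ columns with $0$ in row $i$ and $1$ in row $j$ and at most $p-1$ columns with $1$ in row $i$ and $0$ in row $j$, where an undirected edge is ignored if a directed edge between the same two rows is present. $D(A)$ is the subgraph of directed edges. A deletion is the removal of $s\ge 1$ rows and $t$ columns of $A$ such that the resulting $(m-s)$-rowed matrix is simple; its cost is $c_p s-t$. -}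

module Defs where

open import Data.Bool using (Bool; true; false; if_then_else_)
open import Data.Nat using (ℕ; zero; suc; _+_)
open import Data.Fin using (Fin; zero; suc)
open import Data.Fin.Subset using (Subset; _∈_; ∁; ∣_∣)
open import Data.Integer using (+_)
open import Data.Rational using (ℚ; _/_; _*_; _-_; _≤_; 1ℚ; 0ℚ)
open import Data.Product using (Σ; Σ-syntax; _×_)
open import Data.Sum using (_⊎_)
open import Function using (_∘_)
open import Relation.Binary.PropositionalEquality using (_≡_; _≢_)
open import Relation.Nullary using (¬_)
open import Function.Definitions using (Injective)

Matrix : ℕ → ℕ → Set
Matrix m n = Fin m → Fin n → Bool

Simple : ∀ {m n} → Matrix m n → Set
Simple {m} {n} A = ∀ (c c' : Fin n) → (∀ (r : Fin m) → A r c ≡ A r c') → c ≡ c'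

-- F ≺ A : some submatrix of A is a row and column permutation of F
-- (choose distinct rows via an injection and distinct columns via an injection)
_≺_ : ∀ {k l m n} → Matrix k l → Matrix m n → Set
_≺_ {k} {l} {m} {n} F A =
  Σ[ ρ ∈ (Fin k → Fin m) ] Σ[ κ ∈ (Fin l → Fin n) ]
    Injective _≡_ _≡_ ρ × Injective _≡_ _≡_ κ ×
    (∀ a b → A (ρ a) (κ b) ≡ F a b)

InAvoid : ∀ {k l m n} → Matrix k l → Matrix m n → Set
InAvoid F A = Simple A × ¬ (F ≺ A)

-- F(0,p,1,0): 2 × (p+1) matrix, p columns (1,0)ᵀ and one column (0,1)ᵀ
-- (column index p is the (0,1)ᵀ column, columns 0..p-1 are (1,0)ᵀ)
F0p10 : (p : ℕ) → Matrix 2 (suc p)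
F0p10 p r c = go p r c
  where
  go : (q : ℕ) → Fin 2 → Fin (suc q) → Bool
  go zero    zero       zero    = false
  go zero    (suc zero) zero    = true
  go (suc q) zero       zero    = true
  go (suc q) (suc zero) zero    = false
  go (suc q) r          (suc c) = go q r c

count : ∀ {n} → (Fin n → Bool) → ℕ
count {zero}  f = 0
count {suc n} f = (if f zero then 1 else 0) + count (f ∘ suc)

count01 : ∀ {m n} → Matrix m n → Fin m → Fin m → ℕ
count01 A i j = count (λ c → if A i c then false else A j c)

DirEdge : ∀ {m n} → Matrix m n → Fin m → Fin m → Set
DirEdge {n = n} A i j = ∀ (c : Fin n) → ¬ (A i c ≡ false × A j c ≡ true)

UndirEdge : ∀ {m n} → ℕ → Matrix m n → Fin m → Fin m → Set
UndirEdge p A i j =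
  (count01 A i j Data.Nat.≤ p Data.Nat.∸ 1) × (count01 A j i Data.Nat.≤ p Data.Nat.∸ 1) ×
  ¬ DirEdge A i j × ¬ DirEdge A j i

Joined : ∀ {m n} → ℕ → Matrix m n → Fin m → Fin m → Set
Joined p A i j = DirEdge A i j ⊎ DirEdge A j i ⊎ UndirEdge p A i j

-- the constants c_p (only used for 3 ≤ p ≤ 9)
cConst : ℕ → ℚ
cConst 3 = + 7 / 3
cConst 4 = + 11 / 4
cConst 5 = + 15 / 4
cConst 6 = + 21 / 5
cConst 7 = + 24 / 5
cConst 8 = + 27 / 5
cConst 9 = + 31 / 5
cConst _ = 0ℚ

-- a deletion: keep rows R and columns C (so s = |∁ R| rows and t = |∁ C| columns
-- are removed), with s ≥ 1 and the remaining matrix simple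
IsDeletion : ∀ {m n} → Matrix m n → Subset m → Subset n → Set
IsDeletion {m} {n} A R C =
  1 Data.Nat.≤ ∣ ∁ R ∣ ×
  (∀ (c c' : Fin n) → c ∈ C → c' ∈ C → (∀ (r : Fin m) → r ∈ R → A r c ≡ A r c') → c ≡ c')

cost : ∀ {m n} → ℕ → Subset m → Subset n → ℚ
cost p R C = cConst p * (+ ∣ ∁ R ∣ / 1) - (+ ∣ ∁ C ∣ / 1)

DeletionCost≥1 : ∀ {m n} → ℕ → Matrix m n → Set
DeletionCost≥1 {m} {n} p A =
  Σ[ R ∈ Subset m ] Σ[ C ∈ Subset n ] IsDeletion A R C × 1ℚ ≤ cost p R C

{-# OPTIONS --safe #-}
-- Call c a 01-column from row i to row j if A i c = 0 and A j c = 1. Two rows with no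
-- 01-column in either direction are equal, so deleting one of them keeps A simple at cost
-- c_p ≥ 1. Two rows with 01-columns in both directions are joined by an undirected edge,
-- since p 01-columns from j to i together with one from i to j form a copy of F(0,p,1,0).
-- D(A) is always transitive (a 01-column from i to k is a 01-column from i to j or from
-- j to k), so the last claim holds vacuously.
module Submission where

open import Defs
import Algebra.Lattice.Properties.BooleanAlgebra as BooleanAlgebraProperties
open import Data.Bool using (Bool; true; false; if_then_else_)
import Data.Bool.Properties as Bool
open import Data.Empty using (⊥-elim)
open import Data.Fin using (Fin; zero; suc; inject₁)
import Data.Fin.Properties as Fin
open import Data.Fin.Relation.Unary.Top using (view; ‵fromℕ; ‵inject₁)
open import Data.Fin.Subset using (⁅_⁆; ∁; ∣_∣; ⊤; _∈_)
open import Data.Fin.Subset.Properties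
  using (∣⁅x⁆∣≡1; ∣⊥∣≡0; x≢y⇒x∉⁅y⁆; x∉p⇒x∈∁p; ∪-∩-booleanAlgebra)
open import Data.Integer using (+_)
open import Data.Nat using (ℕ; zero; suc; _≤_; _<_; z≤n; s≤s; _≟_)
open import Data.Nat.Properties using (allUpTo?; <⇒≤pred; ≰⇒>; n≢0⇒n>0; ≤-pred; _≤?_)
open import Data.Product using (Σ-syntax; ∃; _×_; _,_; proj₁; proj₂)
open import Data.Rational using (1ℚ; 0ℚ; _/_; _*_; _-_)
import Data.Rational as ℚ
import Data.Rational.Properties as ℚ
open import Data.Sum using (inj₁; inj₂)
open import Data.Vec.Functional using ([]; _∷_)
open import Function using (_∘_)
open import Function.Definitions using (Injective)
open import Relation.Binary.PropositionalEquality
open import Relation.Nullary using (¬_; yes; no)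
open import Relation.Nullary.Decidable using (toWitness; _→-dec_)

private
  variable
    m n p q : ℕ

count≡0⇒false : (f : Fin n → Bool) → count f ≡ 0 → ∀ c → f c ≡ false
count≡0⇒false {suc n} f h c with f zero in f0
count≡0⇒false {suc n} f () c       | true
count≡0⇒false {suc n} f h zero     | false = f0
count≡0⇒false {suc n} f h (suc c)  | false = count≡0⇒false (f ∘ suc) h c

zero∷suc∘-injective : {g : Fin q → Fin n} →
  Injective _≡_ _≡_ g → Injective _≡_ _≡_ (zero ∷ suc ∘ g)
zero∷suc∘-injective g-injective {zero}  {zero}  _ = refl
zero∷suc∘-injective g-injective {suc a} {suc b} e = cong suc (g-injective (Fin.suc-injective e))

≤count⇒injection : (f : Fin n → Bool) → q ≤ count f →
  Σ[ g ∈ (Fin q → Fin n) ] Injective _≡_ _≡_ g × (∀ k → f (g k) ≡ true)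
≤count⇒injection {q = zero} f _ = (λ ()) , (λ { {()} }) , (λ ())
≤count⇒injection {suc n} {suc q} f q<count with f zero in f0
... | true with ≤count⇒injection (f ∘ suc) (≤-pred q<count)
...   | g , g-injective , f∘suc∘g≡true =
        zero ∷ suc ∘ g , zero∷suc∘-injective g-injective , λ { zero → f0 ; (suc k) → f∘suc∘g≡true k }
≤count⇒injection {suc n} {suc q} f q<count | false with ≤count⇒injection (f ∘ suc) q<count
...   | g , g-injective , f∘suc∘g≡true = suc ∘ g , g-injective ∘ Fin.suc-injective , f∘suc∘g≡true

count01-entry≡true : ∀ {x y : Bool} → (if x then false else y) ≡ true → x ≡ false × y ≡ true
count01-entry≡true {false} {true} _ = refl , refl

count01-entry≡false : ∀ {x y : Bool} → (if x then false else y) ≡ false → ¬ (x ≡ false × y ≡ true)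
count01-entry≡false () (refl , refl)

snoc : {X : Set} → (Fin q → X) → X → Fin (suc q) → X
snoc g x b with view b
... | ‵fromℕ     = x
... | ‵inject₁ k = g k

snoc-injective : {X : Set} {g : Fin q → X} {x : X} →
  Injective _≡_ _≡_ g → (∀ k → g k ≢ x) → Injective _≡_ _≡_ (snoc g x)
snoc-injective g-injective g≢x {b} {b′} eq with view b | view b′
... | ‵fromℕ     | ‵fromℕ      = refl
... | ‵fromℕ     | ‵inject₁ k  = ⊥-elim (g≢x k (sym eq))
... | ‵inject₁ k | ‵fromℕ      = ⊥-elim (g≢x k eq)
... | ‵inject₁ k | ‵inject₁ k′ = cong inject₁ (g-injective eq)

-- `F0p10` is built from a local function that does not compute on a variable `p`.
-- `F0p10′` is the same matrix defined through the top view of `Fin (suc p)`,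
-- and the two are compared by evaluation.
F0p10′ : (p : ℕ) → Matrix 2 (suc p)
F0p10′ p r b with view b
... | ‵fromℕ     = (false ∷ true ∷ []) r
... | ‵inject₁ _ = (true ∷ false ∷ []) r

F0p10′≗F0p10 : p ≤ 9 → ∀ a b → F0p10′ p a b ≡ F0p10 p a b
F0p10′≗F0p10 p≤9 =
  toWitness {a? = allUpTo? (λ p → Fin.all? λ a → Fin.all? λ b → F0p10′ p a b Bool.≟ F0p10 p a b) 10}
    _ (s≤s p≤9)

1≤cConst : 3 ≤ p → p ≤ 9 → 1ℚ ℚ.≤ cConst p
1≤cConst 3≤p p≤9 =
  toWitness {a? = allUpTo? (λ p → 3 ≤? p →-dec 1ℚ ℚ.≤? cConst p) 10} _ (s≤s p≤9) 3≤p

∣∁∁⁅i⁆∣≡1 : (i : Fin m) → ∣ ∁ (∁ ⁅ i ⁆) ∣ ≡ 1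
∣∁∁⁅i⁆∣≡1 {m} i = trans (cong ∣_∣ (¬-involutive ⁅ i ⁆)) (∣⁅x⁆∣≡1 i)
  where open BooleanAlgebraProperties (∪-∩-booleanAlgebra m) using (¬-involutive)

∣∁⊤∣≡0 : ∣ ∁ (⊤ {n}) ∣ ≡ 0
∣∁⊤∣≡0 {n} = trans (cong ∣_∣ ¬⊤≈⊥) (∣⊥∣≡0 n)
  where open BooleanAlgebraProperties (∪-∩-booleanAlgebra n) using (¬⊤≈⊥)

cost-one-row : (i : Fin m) → cost {n = n} p (∁ ⁅ i ⁆) ⊤ ≡ cConst p
cost-one-row {n = n} {p = p} i = begin
  cConst p * (+ ∣ ∁ (∁ ⁅ i ⁆) ∣ / 1) - (+ ∣ ∁ (⊤ {n}) ∣ / 1)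
    ≡⟨ cong₂ (λ s t → cConst p * (+ s / 1) - (+ t / 1)) (∣∁∁⁅i⁆∣≡1 i) (∣∁⊤∣≡0 {n}) ⟩
  cConst p * 1ℚ ℚ.+ 0ℚ  ≡⟨ ℚ.+-identityʳ _ ⟩
  cConst p * 1ℚ         ≡⟨ ℚ.*-identityʳ _ ⟩
  cConst p              ∎
  where open ≡-Reasoning

module _ {m n : ℕ} (A : Matrix m n) where

  Column01 : Fin m → Fin m → Fin n → Set
  Column01 i j c = A i c ≡ false × A j c ≡ true

  count01≡0⇒DirEdge : ∀ {i j} → count01 A i j ≡ 0 → DirEdge A i j
  count01≡0⇒DirEdge count≡0 c = count01-entry≡false (count≡0⇒false _ count≡0 c)

  0<count01⇒Column01 : ∀ {i j} → 0 < count01 A i j → ∃ (Column01 i j)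
  0<count01⇒Column01 0<count with ≤count⇒injection _ 0<count
  ... | g , _ , entry≡true = g zero , count01-entry≡true (entry≡true zero)

  0<count01⇒¬DirEdge : ∀ {i j} → 0 < count01 A i j → ¬ DirEdge A i j
  0<count01⇒¬DirEdge 0<count i→j with 0<count01⇒Column01 0<count
  ... | c , column = i→j c column

  DirEdge-trans : ∀ {i j k} → DirEdge A i j → DirEdge A j k → DirEdge A i k
  DirEdge-trans {j = j} i→j j→k c (i0 , k1) with A j c in j?
  ... | false = j→k c (j? , k1)
  ... | true  = i→j c (i0 , j?)

  DirEdge-antisym : ∀ {i j} → DirEdge A i j → DirEdge A j i → ∀ c → A i c ≡ A j c
  DirEdge-antisym {i} {j} i→j j→i c with A i c in i? | A j c in j?
  ... | false | false = refl
  ... | true  | true  = refl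
  ... | false | true  = ⊥-elim (i→j c (i? , j?))
  ... | true  | false = ⊥-elim (j→i c (j? , i?))

  ≺-respˡ : ∀ {k l} {F F′ : Matrix k l} → (∀ a b → F a b ≡ F′ a b) → F ≺ A → F′ ≺ A
  ≺-respˡ F≗F′ (ρ , κ , ρ-injective , κ-injective , entries) =
    ρ , κ , ρ-injective , κ-injective , λ a b → trans (entries a b) (F≗F′ a b)

  Column01∧p≤count01⇒F0p10′≺ : ∀ {p i j c₀} →
    i ≢ j → Column01 i j c₀ → p ≤ count01 A j i → F0p10′ p ≺ A
  Column01∧p≤count01⇒F0p10′≺ {p} {i} {j} {c₀} i≢j (i0 , j1) p≤count =
    ρ , snoc g c₀ , ρ-injective , snoc-injective g-injective g≢c₀ , entries
    where
    ρ : Fin 2 → Fin m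
    ρ = i ∷ j ∷ []
    ρ-injective : Injective _≡_ _≡_ ρ
    ρ-injective {zero}     {zero}     _ = refl
    ρ-injective {zero}     {suc zero} e = ⊥-elim (i≢j e)
    ρ-injective {suc zero} {zero}     e = ⊥-elim (i≢j (sym e))
    ρ-injective {suc zero} {suc zero} _ = refl
    columns = ≤count⇒injection _ p≤count
    g = proj₁ columns
    g-injective = proj₁ (proj₂ columns)
    g-Column01 : ∀ k → Column01 j i (g k)
    g-Column01 k = count01-entry≡true (proj₂ (proj₂ columns) k)
    g≢c₀ : ∀ k → g k ≢ c₀
    g≢c₀ k e with trans (sym (proj₂ (g-Column01 k))) (trans (cong (A i) e) i0)
    ... | ()
    entries : ∀ a b → A (ρ a) (snoc g c₀ b) ≡ F0p10′ p a b
    entries zero b with view b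
    ... | ‵fromℕ     = i0
    ... | ‵inject₁ k = proj₂ (g-Column01 k)
    entries (suc zero) b with view b
    ... | ‵fromℕ     = j1
    ... | ‵inject₁ k = proj₁ (g-Column01 k)

  avoid⇒count01<p : ∀ {p i j} → ¬ (F0p10′ p ≺ A) → i ≢ j → 0 < count01 A i j → count01 A j i < p
  avoid⇒count01<p {p} {i} {j} avoid i≢j 0<count with p ≤? count01 A j i
  ... | yes p≤count = ⊥-elim (avoid (Column01∧p≤count01⇒F0p10′≺ i≢j column p≤count))
    where column = proj₂ (0<count01⇒Column01 0<count)
  ... | no  p≰count = ≰⇒> p≰count

  avoid⇒Joined : ∀ {p i j} → ¬ (F0p10′ p ≺ A) → i ≢ j → Joined p A i j
  avoid⇒Joined {p} {i} {j} avoid i≢j with count01 A i j ≟ 0 | count01 A j i ≟ 0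
  ... | yes ij≡0 | _        = inj₁ (count01≡0⇒DirEdge ij≡0)
  ... | no _     | yes ji≡0 = inj₂ (inj₁ (count01≡0⇒DirEdge ji≡0))
  ... | no ij≢0  | no ji≢0  = inj₂ (inj₂
    ( <⇒≤pred (avoid⇒count01<p avoid (i≢j ∘ sym) (n≢0⇒n>0 ji≢0))
    , <⇒≤pred (avoid⇒count01<p avoid i≢j (n≢0⇒n>0 ij≢0))
    , 0<count01⇒¬DirEdge (n≢0⇒n>0 ij≢0)
    , 0<count01⇒¬DirEdge (n≢0⇒n>0 ji≢0) ))

  duplicate-row⇒IsDeletion : ∀ {i j} → Simple A → i ≢ j → (∀ c → A i c ≡ A j c) →
    IsDeletion A (∁ ⁅ i ⁆) ⊤
  duplicate-row⇒IsDeletion {i} {j} simple i≢j i≗j =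
    subst (1 ≤_) (sym (∣∁∁⁅i⁆∣≡1 i)) (s≤s z≤n) ,
    λ c c′ _ _ agree → simple c c′ (agree-everywhere agree)
    where
    ≢i⇒∈∁⁅i⁆ : ∀ {r} → r ≢ i → r ∈ ∁ ⁅ i ⁆
    ≢i⇒∈∁⁅i⁆ = x∉p⇒x∈∁p ∘ x≢y⇒x∉⁅y⁆
    agree-everywhere : ∀ {c c′} → (∀ r → r ∈ ∁ ⁅ i ⁆ → A r c ≡ A r c′) → ∀ r → A r c ≡ A r c′
    agree-everywhere {c} {c′} agree r with r Fin.≟ i
    ... | no r≢i   = agree r (≢i⇒∈∁⁅i⁆ r≢i)
    ... | yes refl = begin
      A i c  ≡⟨ i≗j c ⟩
      A j c  ≡⟨ agree j (≢i⇒∈∁⁅i⁆ (i≢j ∘ sym)) ⟩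
      A j c′ ≡⟨ sym (i≗j c′) ⟩
      A i c′ ∎
      where open ≡-Reasoning

  duplicate-row⇒DeletionCost≥1 : ∀ {p i j} → 1ℚ ℚ.≤ cConst p → Simple A → i ≢ j →
    (∀ c → A i c ≡ A j c) → DeletionCost≥1 p A
  duplicate-row⇒DeletionCost≥1 {p} {i} 1≤cConst simple i≢j i≗j =
    ∁ ⁅ i ⁆ , ⊤ , duplicate-row⇒IsDeletion simple i≢j i≗j ,
    subst (1ℚ ℚ.≤_) (sym (cost-one-row {n = n} {p = p} i)) 1≤cConst

mainTheorem10 : (p : ℕ) → 3 ≤ p → p ≤ 9 → (m n : ℕ) → (A : Matrix m n) →
    InAvoid (F0p10 p) A →
      ((i j : Fin m) → i ≢ j → Joined p A i j)
      × ((i j : Fin m) → i ≢ j → DirEdge A i j → DirEdge A j i → DeletionCost≥1 p A)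
      × ((i j k : Fin m) → i ≢ j → j ≢ k → i ≢ k →
           DirEdge A i j → DirEdge A j k → ¬ DirEdge A i k → DeletionCost≥1 p A)
mainTheorem10 p 3≤p p≤9 m n A (simple , avoid) =
    (λ i j → avoid⇒Joined A (avoid ∘ ≺-respˡ A (F0p10′≗F0p10 p≤9)))
  , (λ i j i≢j i→j j→i →
       duplicate-row⇒DeletionCost≥1 A {p = p} (1≤cConst 3≤p p≤9) simple i≢j
         (DirEdge-antisym A i→j j→i))
  , (λ i j k _ _ _ i→j j→k ¬i→k → ⊥-elim (¬i→k (DirEdge-trans A i→j j→k)))
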